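{- Let $K$ be a real quadratic field, $\varepsilon$ its totally positive fundamental unit, and $d_1$ its root dimension. The order of $\varepsilon+2\mathcal{O}_K$ in $(\mathcal{O}_K/2\mathcal{O}_K)^\times$ is $1$ if $d_1\equiv 3\pmod 4$, is $2$ if $d_1\equiv 1\pmod 4$, and is $3$ if $d_1$ is even.
   Context: $K\subset\mathbb{R}$ is a real quadratic field with ring of integers $\mathcal{O}_K$; $\varepsilon$ is the smallest unit of $K$ of norm $+1$ greater than $1$. The root dimension is $d_1=\varepsilon+\varepsilon^{ -1}+1$ (an integer). -}

module Defs where

open import Data.Nat as ℕ using (ℕ; _%_; _/_; _≡ᵇ_)
open import Data.Bool using (if_then_else_)
open import Data.Integer as ℤ using (ℤ; +_; _+_; _*_; -_; _-_; _<_; _≤_; _>_)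
open import Data.Nat.Divisibility as ℕD using ()
open import Data.Integer.Divisibility as ℤD using ()
open import Data.Product using (_×_; _,_; proj₁; proj₂; Σ; ∃)
open import Data.Sum using (_⊎_)
open import Relation.Binary.PropositionalEquality using (_≡_)
open import Relation.Nullary using (¬_)

SquareFree : ℕ → Set
SquareFree D = ∀ p → (p ℕ.* p) ℕD.∣ D → p ≡ 1

-- K = Q(√D) with D > 1 squarefree.
RealQuadratic : ℕ → Set
RealQuadratic D = (2 ℕ.≤ D) × SquareFree D

-- O_K = Z ⊕ Z ω with ω² = t ω + n :
--   D ≡ 1 mod 4 : ω = (1+√D)/2,  t = 1, n = (D-1)/4
--   otherwise   : ω = √D,        t = 0, n = D
tω : ℕ → ℤ
tω D = if D % 4 ≡ᵇ 1 then + 1 else + 0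

nω : ℕ → ℤ
nω D = if D % 4 ≡ᵇ 1 then + (D / 4) else + D

-- element a + b ω of O_K
𝒪 : Set
𝒪 = ℤ × ℤ

ofℤ : ℤ → 𝒪
ofℤ a = a , + 0

one : 𝒪
one = ofℤ (+ 1)

_⊕_ : 𝒪 → 𝒪 → 𝒪
(a , b) ⊕ (c , d) = (a + c) , (b + d)

_⊖_ : 𝒪 → 𝒪 → 𝒪
(a , b) ⊖ (c , d) = (a - c) , (b - d)

mul : ℕ → 𝒪 → 𝒪 → 𝒪
mul D (a , b) (c , d) = (a * c + b * d * nω D) , (a * d + b * c + b * d * tω D)

pow : ℕ → 𝒪 → ℕ → 𝒪
pow D α ℕ.zero = one
pow D α (ℕ.suc k) = mul D α (pow D α k)

-- Galois conjugate: ω ↦ t - ω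
conj : ℕ → 𝒪 → 𝒪
conj D (a , b) = (a + b * tω D) , (- b)

norm : ℕ → 𝒪 → ℤ
norm D α = proj₁ (mul D α (conj D α))

IsUnit : ℕ → 𝒪 → Set
IsUnit D α = ∃ λ β → mul D α β ≡ one

-- x + y √D > 0 in the real embedding (x, y ∈ ℤ)
PosSqrt : ℕ → ℤ → ℤ → Set
PosSqrt D x y =
    (x > + 0 × y ℤ.≥ + 0)
  ⊎ (x ℤ.≥ + 0 × y > + 0)
  ⊎ (x > + 0 × y < + 0 × (+ D) * y * y < x * x)
  ⊎ (x < + 0 × y > + 0 × x * x < (+ D) * y * y)

-- a + b ω = ((2a + b t) + b √D)/2 > 0 in the real embedding K ⊂ ℝ
Pos : ℕ → 𝒪 → Set
Pos D (a , b) = PosSqrt D (+ 2 * a + b * tω D) b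

_<[_]_ : 𝒪 → ℕ → 𝒪 → Set
α <[ D ] β = Pos D (β ⊖ α)

_≤[_]_ : 𝒪 → ℕ → 𝒪 → Set
α ≤[ D ] β = (α ≡ β) ⊎ (α <[ D ] β)

IsFundUnit⁺ : ℕ → 𝒪 → Set
IsFundUnit⁺ D ε =
  IsUnit D ε × norm D ε ≡ + 1 × one <[ D ] ε ×
  (∀ η → IsUnit D η → norm D η ≡ + 1 → one <[ D ] η → ε ≤[ D ] η)

In2O : 𝒪 → Set
In2O (a , b) = (+ 2 ℤD.∣ a) × (+ 2 ℤD.∣ b)

_≡[_]2_ : 𝒪 → ℕ → 𝒪 → Set
α ≡[ D ]2 β = In2O (α ⊖ β)

OrderMod2 : ℕ → 𝒪 → ℕ → Set
OrderMod2 D α k =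
  (1 ℕ.≤ k) × (pow D α k ≡[ D ]2 one) ×
  (∀ j → 1 ℕ.≤ j → j ℕ.< k → ¬ (pow D α j ≡[ D ]2 one))

{-# OPTIONS --safe #-}
module Submission where

open import Defs
open import Level using (0ℓ)
open import Data.Nat as ℕ using (ℕ; s≤s; z≤n)
open import Data.Nat.Divisibility using (∣1⇒≡1) renaming (_∣_ to _∣ℕ_)
open import Data.Nat.Primality using (Prime; prime[2]; prime⇒nonZero; euclidsLemma)
open import Data.Integer.Base using (ℤ; +_; -_; +-*-rawRing)
import Data.Integer.Properties as ℤₚ
open import Data.Integer.DivMod using (_%ℕ_; _/ℕ_; a≡a%ℕn+[a/ℕn]*n)
open import Data.Integer.Divisibility.Signed
  using (_∣_; divides; ∣ᵤ⇒∣; ∣⇒∣ᵤ; ∣-refl; ∣-trans; ∣m∣n⇒∣m-n; ∣m∣n⇒∣m+n; ∣m+n∣m⇒∣n;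
         ∣m+n∣n⇒∣m; ∣n⇒∣m*n; ∣m⇒∣m*n; *-monoʳ-∣; *-monoˡ-∣; *-cancelˡ-∣; *-cancelʳ-∣)
open import Data.Integer.Tactic.RingSolver using (solve-∀)
open import Data.Product using (_×_; _,_; proj₁)
open import Data.Sum as Sum using (_⊎_; inj₁; inj₂)
open import Data.Bool using (true; false; if_then_else_)
import Data.Maybe as Maybe
open import Data.Empty using (⊥-elim)
open import Function using (id; _∘_)
open import Algebra.Bundles using (CommutativeRing)
open import Algebra.Consequences.Propositional using (comm∧idˡ⇒id; comm∧invˡ⇒inv; comm∧distrʳ⇒distrˡ)
open import Algebra.Solver.Ring.AlmostCommutativeRing
  using (_-Raw-AlmostCommutative⟶_; fromCommutativeRing)
import Algebra.Solver.Ring as RingSolver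
open import Relation.Binary.Consequences using (dec⇒weaklyDec)
open import Relation.Binary.PropositionalEquality
open import Algebra.Structures {A = 𝒪} _≡_ using (IsCommutativeRing)
open import Relation.Nullary using (¬_; contradiction)

-- Since ε ε⁻¹ = 1 and ε + ε⁻¹ = d₁ - 1, the unit ε satisfies ε² + ε + 1 = d₁ ε in O_K.
-- If d₁ is even, ε is a root of X² + X + 1 modulo 2, so ε³ ≡ 1, while ε ≡ 1 would give
-- 0 ≡ 3 and ε² ≡ 1 would give ε ≡ 0, impossible for a unit.  If d₁ is odd, then
-- ε² - 1 = (d₁ - 1) ε - 2 ≡ 0, and whether ε ≡ 1 is decided by (ε - 1)² = (d₁ - 3) ε:
-- for d₁ ≡ 3 (mod 4) the right-hand side lies in 4 O_K, and O_K being integrally closed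
-- gives ε - 1 ∈ 2 O_K; for d₁ ≡ 1 (mod 4), ε - 1 ∈ 2 O_K would put (d₁ - 3) ε into 4 O_K
-- with d₁ - 3 ≡ 2 (mod 4), hence ε into 2 O_K.

module _ where
  open import Data.Integer.Base using (_+_; _*_; _-_)

  *-pres-∣ : ∀ {k l a c} → k ∣ a → l ∣ c → k * l ∣ a * c
  *-pres-∣ {k} {l} {a} k∣a l∣c = ∣-trans (*-monoˡ-∣ l k∣a) (*-monoʳ-∣ a l∣c)

  prime∣*⇒∣⊎∣ : ∀ {p} → Prime p → ∀ i j → + p ∣ i * j → + p ∣ i ⊎ + p ∣ j
  prime∣*⇒∣⊎∣ p-prime i j p∣ij = Sum.map ∣ᵤ⇒∣ ∣ᵤ⇒∣
    (euclidsLemma _ _ p-prime (subst (_ ∣ℕ_) (ℤₚ.abs-* i j) (∣⇒∣ᵤ p∣ij)))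

  prime∣²⇒∣ : ∀ {p} → Prime p → ∀ i → + p ∣ i * i → + p ∣ i
  prime∣²⇒∣ p-prime i p∣ii = Sum.[ id , id ] (prime∣*⇒∣⊎∣ p-prime i i p∣ii)

  prime²∤n∧prime²∣i²n⇒∣i : ∀ {p n} → Prime p → ¬ (+ p * + p ∣ n) → ∀ i →
                           + p * + p ∣ i * i * n → + p ∣ i
  prime²∤n∧prime²∣i²n⇒∣i {p} {n} p-prime p²∤n i p²∣i²n
    with prime∣*⇒∣⊎∣ p-prime (i * i) n (∣-trans (∣m⇒∣m*n {+ p} {+ p} (+ p) ∣-refl) p²∣i²n)
  ... | inj₁ p∣i² = prime∣²⇒∣ p-prime i p∣i²
  ... | inj₂ (divides q refl)
    with prime∣*⇒∣⊎∣ p-prime (i * i) q (*-cancelʳ-∣ (+ p) {+ p} {i * i * q} {{prime⇒nonZero p-prime}}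
           (subst (+ p * + p ∣_) (sym (ℤₚ.*-assoc (i * i) q (+ p))) p²∣i²n))
  ...   | inj₁ p∣i² = prime∣²⇒∣ p-prime i p∣i²
  ...   | inj₂ p∣q = ⊥-elim (p²∤n (*-monoˡ-∣ (+ p) {+ p} {q} p∣q))

  2∤1 : ¬ + 2 ∣ + 1
  2∤1 2∣1 with ∣1⇒≡1 (∣⇒∣ᵤ 2∣1)
  ... | ()

  2∣4 : + 2 ∣ + 4
  2∣4 = divides (+ 2) refl

  %ℕ≡⇒∣- : ∀ i k .{{_ : ℕ.NonZero k}} {r} → i %ℕ k ≡ r → + k ∣ i - + r
  %ℕ≡⇒∣- i k refl = divides (i /ℕ k) (begin
    i - + (i %ℕ k)                        ≡⟨ cong (_- + (i %ℕ k)) (a≡a%ℕn+[a/ℕn]*n i k) ⟩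
    + (i %ℕ k) + i /ℕ k * + k - + (i %ℕ k) ≡⟨ cancel (+ (i %ℕ k)) (i /ℕ k * + k) ⟩
    i /ℕ k * + k                          ∎)
    where
    open ≡-Reasoning
    cancel : ∀ a b → a + b - a ≡ b
    cancel = solve-∀

  4∣m+2⇒4∣mi⇒2∣i : ∀ {m} i → + 4 ∣ m + + 2 → + 4 ∣ m * i → + 2 ∣ i
  4∣m+2⇒4∣mi⇒2∣i {m} i 4∣m+2 4∣mi = *-cancelˡ-∣ (+ 2) {+ 2} {i}
    (∣m+n∣m⇒∣n {+ 4} {m * i} {+ 2 * i}
      (subst (+ 4 ∣_) (ℤₚ.*-distribʳ-+ i m (+ 2)) (∣m⇒∣m*n {+ 4} {m + + 2} i 4∣m+2)) 4∣mi)

neg : 𝒪 → 𝒪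
neg (a , b) = - a , - b

module _ (D : ℕ) where
  open import Data.Integer.Base using (_+_; _*_)

  private
    n t : ℤ
    n = nω D
    t = tω D

  ⊕-assoc : ∀ α β γ → (α ⊕ β) ⊕ γ ≡ α ⊕ (β ⊕ γ)
  ⊕-assoc (a , b) (c , d) (e , f) = cong₂ _,_ (ℤₚ.+-assoc a c e) (ℤₚ.+-assoc b d f)

  ⊕-comm : ∀ α β → α ⊕ β ≡ β ⊕ α
  ⊕-comm (a , b) (c , d) = cong₂ _,_ (ℤₚ.+-comm a c) (ℤₚ.+-comm b d)

  ⊕-identityˡ : ∀ α → ofℤ (+ 0) ⊕ α ≡ α
  ⊕-identityˡ (a , b) = cong₂ _,_ (ℤₚ.+-identityˡ a) (ℤₚ.+-identityˡ b)

  ⊕-inverseˡ : ∀ α → neg α ⊕ α ≡ ofℤ (+ 0)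
  ⊕-inverseˡ (a , b) = cong₂ _,_ (ℤₚ.+-inverseˡ a) (ℤₚ.+-inverseˡ b)

  mul-comm : ∀ α β → mul D α β ≡ mul D β α
  mul-comm (a , b) (c , d) = cong₂ _,_ (coeff₁ a b c d n) (coeffω a b c d t)
    where
    coeff₁ : ∀ a b c d n → a * c + b * d * n ≡ c * a + d * b * n
    coeff₁ = solve-∀
    coeffω : ∀ a b c d t → a * d + b * c + b * d * t ≡ c * b + d * a + d * b * t
    coeffω = solve-∀

  mul-assoc : ∀ α β γ → mul D (mul D α β) γ ≡ mul D α (mul D β γ)
  mul-assoc (a , b) (c , d) (e , f) = cong₂ _,_ (coeff₁ a b c d e f n t) (coeffω a b c d e f n t)
    where
    coeff₁ : ∀ a b c d e f n t →
      (a * c + b * d * n) * e + (a * d + b * c + b * d * t) * f * n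
        ≡ a * (c * e + d * f * n) + b * (c * f + d * e + d * f * t) * n
    coeff₁ = solve-∀
    coeffω : ∀ a b c d e f n t →
      (a * c + b * d * n) * f + (a * d + b * c + b * d * t) * e
          + (a * d + b * c + b * d * t) * f * t
        ≡ a * (c * f + d * e + d * f * t) + b * (c * e + d * f * n)
          + b * (c * f + d * e + d * f * t) * t
    coeffω = solve-∀

  mul-identityˡ : ∀ α → mul D one α ≡ α
  mul-identityˡ (a , b) = cong₂ _,_ (coeff₁ a b n) (coeffω a b t)
    where
    coeff₁ : ∀ a b n → + 1 * a + + 0 * b * n ≡ a
    coeff₁ = solve-∀
    coeffω : ∀ a b t → + 1 * b + + 0 * a + + 0 * b * t ≡ b
    coeffω = solve-∀

  mul-distribʳ : ∀ α β γ → mul D (β ⊕ γ) α ≡ mul D β α ⊕ mul D γ α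
  mul-distribʳ (a , b) (c , d) (e , f) = cong₂ _,_ (coeff₁ a b c d e f n) (coeffω a b c d e f t)
    where
    coeff₁ : ∀ a b c d e f n →
      (c + e) * a + (d + f) * b * n ≡ (c * a + d * b * n) + (e * a + f * b * n)
    coeff₁ = solve-∀
    coeffω : ∀ a b c d e f t →
      (c + e) * b + (d + f) * a + (d + f) * b * t
        ≡ (c * b + d * a + d * b * t) + (e * b + f * a + f * b * t)
    coeffω = solve-∀

  isCommutativeRing : IsCommutativeRing _⊕_ (mul D) neg (ofℤ (+ 0)) one
  isCommutativeRing = record
    { isRing = record
      { +-isAbelianGroup = record
        { isGroup = record
          { isMonoid = record
            { isSemigroup = record
              { isMagma = record { isEquivalence = isEquivalence ; ∙-cong = cong₂ _⊕_ }
              ; assoc = ⊕-assoc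
              }
            ; identity = comm∧idˡ⇒id ⊕-comm ⊕-identityˡ
            }
          ; inverse = comm∧invˡ⇒inv ⊕-comm ⊕-inverseˡ
          ; ⁻¹-cong = cong neg
          }
        ; comm = ⊕-comm
        }
      ; *-cong = cong₂ (mul D)
      ; *-assoc = mul-assoc
      ; *-identity = comm∧idˡ⇒id mul-comm mul-identityˡ
      ; distrib = comm∧distrʳ⇒distrˡ mul-comm mul-distribʳ , mul-distribʳ
      }
    ; *-comm = mul-comm
    }

  commutativeRing : CommutativeRing 0ℓ 0ℓ
  commutativeRing = record { isCommutativeRing = isCommutativeRing }

  ofℤ-homomorphism : +-*-rawRing -Raw-AlmostCommutative⟶ fromCommutativeRing commutativeRing
  ofℤ-homomorphism = record
    { ⟦_⟧ = ofℤ
    ; +-homo = λ _ _ → refl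
    ; *-homo = λ a b → cong₂ _,_ (sym (ℤₚ.+-identityʳ (a * b))) (sym (coeffω a b))
    ; -‿homo = λ _ → refl
    ; 0-homo = refl
    ; 1-homo = refl
    }
    where
    coeffω : ∀ a b → a * + 0 + + 0 + + 0 ≡ + 0
    coeffω = solve-∀

-- Coefficients are taken in ℤ rather than in 𝒪: with coefficients in 𝒪, normalisation would
-- have to compute with the symbolic multiplication table nω D, tω D and gets stuck.
module 𝒪-Solver (D : ℕ) = RingSolver +-*-rawRing (fromCommutativeRing (commutativeRing D))
  (ofℤ-homomorphism D) (λ a b → Maybe.map (cong ofℤ) (dec⇒weaklyDec ℤₚ._≟_ a b))

infix 4 _∣ᴼ_

_∣ᴼ_ : ℤ → 𝒪 → Set
k ∣ᴼ (a , b) = k ∣ a × k ∣ b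

In2O⇒2∣ᴼ : ∀ {α} → In2O α → + 2 ∣ᴼ α
In2O⇒2∣ᴼ (2∣a , 2∣b) = ∣ᵤ⇒∣ 2∣a , ∣ᵤ⇒∣ 2∣b

2∣ᴼ⇒In2O : ∀ {α} → + 2 ∣ᴼ α → In2O α
2∣ᴼ⇒In2O (2∣a , 2∣b) = ∣⇒∣ᵤ 2∣a , ∣⇒∣ᵤ 2∣b

module _ {k : ℤ} where
  open import Data.Integer.Base using (_*_)

  ∣ᴼ-⊖ : ∀ {α β} → k ∣ᴼ α → k ∣ᴼ β → k ∣ᴼ α ⊖ β
  ∣ᴼ-⊖ (k∣a , k∣b) (k∣c , k∣d) = ∣m∣n⇒∣m-n k∣a k∣c , ∣m∣n⇒∣m-n k∣b k∣d

  ∣ᴼ-ofℤ : ∀ {m} → k ∣ m → k ∣ᴼ ofℤ m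
  ∣ᴼ-ofℤ k∣m = k∣m , divides (+ 0) refl

  ∣ᴼ-mulʳ : ∀ D α {β} → k ∣ᴼ β → k ∣ᴼ mul D α β
  ∣ᴼ-mulʳ D (a , b) (k∣c , k∣d) =
    ∣m∣n⇒∣m+n (∣n⇒∣m*n a k∣c) (∣m⇒∣m*n (nω D) (∣n⇒∣m*n b k∣d)) ,
    ∣m∣n⇒∣m+n (∣m∣n⇒∣m+n (∣n⇒∣m*n a k∣d) (∣n⇒∣m*n b k∣c)) (∣m⇒∣m*n (tω D) (∣n⇒∣m*n b k∣d))

  ∣ᴼ-mulˡ : ∀ D {α} β → k ∣ᴼ α → k ∣ᴼ mul D α β
  ∣ᴼ-mulˡ D {α} β k∣α = subst (k ∣ᴼ_) (mul-comm D β α) (∣ᴼ-mulʳ D β k∣α)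

  ∣ᴼ-mul : ∀ D {l α β} → k ∣ᴼ α → l ∣ᴼ β → k * l ∣ᴼ mul D α β
  ∣ᴼ-mul D (k∣a , k∣b) (l∣c , l∣d) =
    ∣m∣n⇒∣m+n (*-pres-∣ k∣a l∣c) (∣m⇒∣m*n (nω D) (*-pres-∣ k∣b l∣d)) ,
    ∣m∣n⇒∣m+n (∣m∣n⇒∣m+n (*-pres-∣ k∣a l∣d) (*-pres-∣ k∣b l∣c)) (∣m⇒∣m*n (tω D) (*-pres-∣ k∣b l∣d))

  ∣ᴼ-unit : ∀ D {α β} → k ∣ᴼ α → mul D α β ≡ one → k ∣ + 1
  ∣ᴼ-unit D {β = β} k∣α αβ≡1 = proj₁ (subst (k ∣ᴼ_) αβ≡1 (∣ᴼ-mulˡ D β k∣α))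

tω≡1⊎tω≡0∧nω≡D : ∀ D → tω D ≡ + 1 ⊎ (tω D ≡ + 0 × nω D ≡ + D)
tω≡1⊎tω≡0∧nω≡D D = by-cases (D ℕ.% 4 ℕ.≡ᵇ 1)
  where
  by-cases : ∀ b → (if b then + 1 else + 0) ≡ + 1
                 ⊎ ((if b then + 1 else + 0) ≡ + 0 × (if b then + (D ℕ./ 4) else + D) ≡ + D)
  by-cases true = inj₁ refl
  by-cases false = inj₂ (refl , refl)

module _ (D : ℕ) where
  open import Data.Integer.Base using (_+_; _*_; _-_)

  -- (γ/2)² ∈ O_K forces γ/2 ∈ O_K.  The ω-coordinate y is shown even first: from the
  -- ω-coefficient 2xy + y² of γ² when t = 1, and from 4 ∤ D when t = 0.
  4∣ᴼγ²⇒2∣ᴼγ : SquareFree D → ∀ γ → + 4 ∣ᴼ mul D γ γ → + 2 ∣ᴼ γ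
  4∣ᴼγ²⇒2∣ᴼγ squareFree (x , y) (4∣x²+y²n , 4∣2xy+y²t) = 2∣x , 2∣y
    where
    4∣2xy+y²t-at : ∀ {t} → tω D ≡ t → + 4 ∣ x * y + y * x + y * y * t
    4∣2xy+y²t-at t≡ = subst (λ t → + 4 ∣ x * y + y * x + y * y * t) t≡ 4∣2xy+y²t

    t≡1⇒2∣y : tω D ≡ + 1 → + 2 ∣ y
    t≡1⇒2∣y t≡1 = prime∣²⇒∣ prime[2] y (∣m+n∣n⇒∣m {+ 2} {y * y} {x * y * + 2}
        (subst (+ 2 ∣_) (regroup x y) (∣-trans 2∣4 (4∣2xy+y²t-at t≡1)))
        (∣n⇒∣m*n (x * y) ∣-refl))
      where
      regroup : ∀ x y → x * y + y * x + y * y * + 1 ≡ y * y + x * y * + 2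
      regroup = solve-∀

    t≡0⇒2∣y : tω D ≡ + 0 × nω D ≡ + D → + 2 ∣ y
    t≡0⇒2∣y (t≡0 , n≡D) = Sum.[ 2∣x⇒2∣y , id ] (prime∣*⇒∣⊎∣ prime[2] x y 2∣xy)
      where
      regroup : ∀ x y → x * y + y * x + y * y * + 0 ≡ + 2 * (x * y)
      regroup = solve-∀
      2∣xy : + 2 ∣ x * y
      2∣xy = *-cancelˡ-∣ (+ 2) {+ 2} {x * y} (subst (+ 4 ∣_) (regroup x y) (4∣2xy+y²t-at t≡0))
      4∤D : ¬ (+ 2 * + 2 ∣ + D)
      4∤D 4∣D = contradiction (squareFree 2 (∣⇒∣ᵤ 4∣D)) λ ()
      2∣x⇒2∣y : + 2 ∣ x → + 2 ∣ y
      2∣x⇒2∣y 2∣x = prime²∤n∧prime²∣i²n⇒∣i prime[2] 4∤D y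
        (subst (λ n → + 4 ∣ y * y * n) n≡D
          (∣m+n∣m⇒∣n {+ 4} {x * x} {y * y * nω D} 4∣x²+y²n (*-pres-∣ {+ 2} {+ 2} 2∣x 2∣x)))

    2∣y : + 2 ∣ y
    2∣y = Sum.[ t≡1⇒2∣y , t≡0⇒2∣y ] (tω≡1⊎tω≡0∧nω≡D D)

    2∣x : + 2 ∣ x
    2∣x = prime∣²⇒∣ prime[2] x (∣-trans 2∣4
            (∣m+n∣n⇒∣m {+ 4} {x * x} {y * y * nω D} 4∣x²+y²n
              (∣m⇒∣m*n {+ 4} {y * y} (nω D) (*-pres-∣ {+ 2} {+ 2} 2∣y 2∣y))))

  ∣ᴼ-halve : ∀ {m} → + 4 ∣ m + + 2 → ∀ α → + 4 ∣ᴼ mul D (ofℤ m) α → + 2 ∣ᴼ α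
  ∣ᴼ-halve {m} 4∣m+2 (a , b) (4∣ma , 4∣mb) =
    4∣m+2⇒4∣mi⇒2∣i {m} a 4∣m+2 (subst (+ 4 ∣_) (ℤₚ.+-identityʳ (m * a)) 4∣ma) ,
    4∣m+2⇒4∣mi⇒2∣i {m} b 4∣m+2
      (subst (+ 4 ∣_) (trans (ℤₚ.+-identityʳ (m * b + + 0)) (ℤₚ.+-identityʳ (m * b))) 4∣mb)

module RootDimension (D : ℕ) (x y : 𝒪) (d : ℤ)
  (xy≡1 : mul D x y ≡ one) (x+y+1≡d : (x ⊕ y) ⊕ one ≡ ofℤ d) where

  open import Data.Integer.Base using () renaming (_+_ to _+ℤ_; _-_ to _-ℤ_)
  open CommutativeRing (commutativeRing D) using (_+_; _*_; _-_; 1#; *-comm)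
  open 𝒪-Solver D using (solve; _:=_; _:+_; _:*_; _:-_; _:^_; con)
  open ≡-Reasoning

  x²+x+1≡dx : x * x + x + 1# ≡ ofℤ d * x
  x²+x+1≡dx = begin
    x * x + x + 1#     ≡⟨ cong (λ z → x * x + x + z) (sym xy≡1) ⟩
    x * x + x + x * y  ≡⟨ solve 2 (λ x y → x :* x :+ x :+ x :* y := x :* (x :+ y :+ con (+ 1))) refl x y ⟩
    x * (x + y + 1#)   ≡⟨ cong (x *_) x+y+1≡d ⟩
    x * ofℤ d          ≡⟨ *-comm x (ofℤ d) ⟩
    ofℤ d * x          ∎

  2∤ᴼx : ¬ + 2 ∣ᴼ x
  2∤ᴼx 2∣x = 2∤1 (∣ᴼ-unit D 2∣x xy≡1)

  module _ (2∣d : + 2 ∣ d) where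

    2∣ᴼx²+x+1 : + 2 ∣ᴼ x * x + x + 1#
    2∣ᴼx²+x+1 = subst (+ 2 ∣ᴼ_) (sym x²+x+1≡dx) (∣ᴼ-mulˡ D x (∣ᴼ-ofℤ 2∣d))

    2∣d⇒2∣ᴼx³-1 : + 2 ∣ᴼ pow D x 3 - 1#
    2∣d⇒2∣ᴼx³-1 = subst (+ 2 ∣ᴼ_)
      (solve 1 (λ x → (x :- con (+ 1)) :* (x :* x :+ x :+ con (+ 1)) := x :^ 3 :- con (+ 1)) refl x)
      (∣ᴼ-mulʳ D (x - 1#) 2∣ᴼx²+x+1)

    2∣d⇒2∤ᴼx-1 : ¬ + 2 ∣ᴼ pow D x 1 - 1#
    2∣d⇒2∤ᴼx-1 2∣x-1 = 2∤1 (proj₁ (subst (+ 2 ∣ᴼ_)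
      (solve 1 (λ x → x :* x :+ x :+ con (+ 1) :- (x :^ 1 :- con (+ 1)) :* (x :+ con (+ 2)) :- con (+ 2)
                        := con (+ 1)) refl x)
      (∣ᴼ-⊖ (∣ᴼ-⊖ 2∣ᴼx²+x+1 (∣ᴼ-mulˡ D (x + ofℤ (+ 2)) 2∣x-1)) (∣ᴼ-ofℤ ∣-refl))))

    2∣d⇒2∤ᴼx²-1 : ¬ + 2 ∣ᴼ pow D x 2 - 1#
    2∣d⇒2∤ᴼx²-1 2∣x²-1 = 2∤ᴼx (subst (+ 2 ∣ᴼ_)
      (solve 1 (λ x → x :* x :+ x :+ con (+ 1) :- (x :^ 2 :- con (+ 1)) :- con (+ 2) := x) refl x)
      (∣ᴼ-⊖ (∣ᴼ-⊖ 2∣ᴼx²+x+1 2∣x²-1) (∣ᴼ-ofℤ ∣-refl)))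

  2∣d-1⇒2∣ᴼx²-1 : + 2 ∣ d -ℤ + 1 → + 2 ∣ᴼ pow D x 2 - 1#
  2∣d-1⇒2∣ᴼx²-1 2∣d-1 = subst (+ 2 ∣ᴼ_) (sym x²-1≡[d-1]x-2)
    (∣ᴼ-⊖ (∣ᴼ-mulˡ D x (∣ᴼ-ofℤ 2∣d-1)) (∣ᴼ-ofℤ ∣-refl))
    where
    x²-1≡[d-1]x-2 : pow D x 2 - 1# ≡ ofℤ (d -ℤ + 1) * x - ofℤ (+ 2)
    x²-1≡[d-1]x-2 = begin
      pow D x 2 - 1#
        ≡⟨ solve 1 (λ x → x :^ 2 :- con (+ 1) := x :* x :+ x :+ con (+ 1) :- x :- con (+ 2)) refl x ⟩
      x * x + x + 1# - x - ofℤ (+ 2)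
        ≡⟨ cong (λ z → z - x - ofℤ (+ 2)) x²+x+1≡dx ⟩
      ofℤ d * x - x - ofℤ (+ 2)
        ≡⟨ solve 2 (λ δ x → δ :* x :- x :- con (+ 2) := (δ :- con (+ 1)) :* x :- con (+ 2)) refl (ofℤ d) x ⟩
      ofℤ (d -ℤ + 1) * x - ofℤ (+ 2)
        ∎

  [x-1]²≡[d-3]x : (pow D x 1 - 1#) * (pow D x 1 - 1#) ≡ ofℤ (d -ℤ + 3) * x
  [x-1]²≡[d-3]x = begin
    (pow D x 1 - 1#) * (pow D x 1 - 1#)
      ≡⟨ solve 1 (λ x → (x :^ 1 :- con (+ 1)) :* (x :^ 1 :- con (+ 1))
                          := x :* x :+ x :+ con (+ 1) :- con (+ 3) :* x) refl x ⟩
    x * x + x + 1# - ofℤ (+ 3) * x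
      ≡⟨ cong (λ z → z - ofℤ (+ 3) * x) x²+x+1≡dx ⟩
    ofℤ d * x - ofℤ (+ 3) * x
      ≡⟨ solve 2 (λ δ x → δ :* x :- con (+ 3) :* x := (δ :- con (+ 3)) :* x) refl (ofℤ d) x ⟩
    ofℤ (d -ℤ + 3) * x
      ∎

  4∣d-3⇒2∣ᴼx-1 : SquareFree D → + 4 ∣ d -ℤ + 3 → + 2 ∣ᴼ pow D x 1 - 1#
  4∣d-3⇒2∣ᴼx-1 squareFree 4∣d-3 = 4∣ᴼγ²⇒2∣ᴼγ D squareFree (pow D x 1 - 1#)
    (subst (+ 4 ∣ᴼ_) (sym [x-1]²≡[d-3]x) (∣ᴼ-mulˡ D x (∣ᴼ-ofℤ 4∣d-3)))

  4∣d-1⇒2∤ᴼx-1 : + 4 ∣ d -ℤ + 1 → ¬ + 2 ∣ᴼ pow D x 1 - 1#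
  4∣d-1⇒2∤ᴼx-1 4∣d-1 2∣x-1 = 2∤ᴼx (∣ᴼ-halve D {d -ℤ + 3} (subst (+ 4 ∣_) (d-1≡d-3+2 d) 4∣d-1) x
    (subst (+ 4 ∣ᴼ_) [x-1]²≡[d-3]x (∣ᴼ-mul D 2∣x-1 2∣x-1)))
    where
    d-1≡d-3+2 : ∀ d → d -ℤ + 1 ≡ d -ℤ + 3 +ℤ + 2
    d-1≡d-3+2 = solve-∀

module _ (D : ℕ) {α : 𝒪} where

  orderMod2-1 : + 2 ∣ᴼ pow D α 1 ⊖ one → OrderMod2 D α 1
  orderMod2-1 α≡1 = s≤s z≤n , 2∣ᴼ⇒In2O α≡1 , λ { (ℕ.suc j) _ (s≤s ()) }

  orderMod2-2 : + 2 ∣ᴼ pow D α 2 ⊖ one → ¬ + 2 ∣ᴼ pow D α 1 ⊖ one → OrderMod2 D α 2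
  orderMod2-2 α²≡1 α≢1 = s≤s z≤n , 2∣ᴼ⇒In2O α²≡1 , smaller
    where
    smaller : ∀ j → 1 ℕ.≤ j → j ℕ.< 2 → ¬ In2O (pow D α j ⊖ one)
    smaller 1 _ _ = α≢1 ∘ In2O⇒2∣ᴼ
    smaller (ℕ.suc (ℕ.suc _)) _ (s≤s (s≤s ()))

  orderMod2-3 : + 2 ∣ᴼ pow D α 3 ⊖ one → ¬ + 2 ∣ᴼ pow D α 1 ⊖ one → ¬ + 2 ∣ᴼ pow D α 2 ⊖ one →
                OrderMod2 D α 3
  orderMod2-3 α³≡1 α≢1 α²≢1 = s≤s z≤n , 2∣ᴼ⇒In2O α³≡1 , smaller
    where
    smaller : ∀ j → 1 ℕ.≤ j → j ℕ.< 3 → ¬ In2O (pow D α j ⊖ one)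
    smaller 1 _ _ = α≢1 ∘ In2O⇒2∣ᴼ
    smaller 2 _ _ = α²≢1 ∘ In2O⇒2∣ᴼ
    smaller (ℕ.suc (ℕ.suc (ℕ.suc _))) _ (s≤s (s≤s (s≤s ())))

lemma6p12 : (D : ℕ) → RealQuadratic D →
    (ε εinv : 𝒪) → IsFundUnit⁺ D ε → mul D ε εinv ≡ one →
    (d₁ : ℤ) → (ε ⊕ εinv) ⊕ one ≡ ofℤ d₁ →
    ((d₁ %ℕ 4 ≡ 3 → OrderMod2 D ε 1) ×
     (d₁ %ℕ 4 ≡ 1 → OrderMod2 D ε 2) ×
     (d₁ %ℕ 2 ≡ 0 → OrderMod2 D ε 3))
lemma6p12 D (_ , squareFree) ε εinv _ εεinv≡1 d₁ ε+εinv+1≡d₁ =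
  (λ d₁≡3 → orderMod2-1 D (4∣d-3⇒2∣ᴼx-1 squareFree (%ℕ≡⇒∣- d₁ 4 d₁≡3))) ,
  (λ d₁≡1 → orderMod2-2 D (2∣d-1⇒2∣ᴼx²-1 (∣-trans 2∣4 (%ℕ≡⇒∣- d₁ 4 d₁≡1)))
                          (4∣d-1⇒2∤ᴼx-1 (%ℕ≡⇒∣- d₁ 4 d₁≡1))) ,
  (λ d₁≡0 → let 2∣d₁ = subst (+ 2 ∣_) (ℤₚ.+-identityʳ d₁) (%ℕ≡⇒∣- d₁ 2 d₁≡0) in
            orderMod2-3 D (2∣d⇒2∣ᴼx³-1 2∣d₁) (2∣d⇒2∤ᴼx-1 2∣d₁) (2∣d⇒2∤ᴼx²-1 2∣d₁))
  where open RootDimension D ε εinv d₁ εεinv≡1 ε+εinv+1≡d₁
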